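{- The syntactic $\lambda$-model $\mathcal{S}$ is not extensional; that is, the combinatory algebra $(\mathbb{A}/_{\simeq^{ae}},\bullet,[\![\lambda xy.x]\!],[\![\lambda xyz.xz(yz)]\!])$ is not extensional. Equivalently, $[\![\lambda xy.xy]\!]\neq[\![\lambda x.x]\!]$ in $\mathcal{S}$.
   Context: Addressing machines. Fix a countable set $\mathbb{A}$ of addresses and a symbol $\varnothing\notin\mathbb{A}$; $\mathbb{A}_\varnothing=\mathbb{A}\cup\{\varnothing\}$. A tape is a finite list of elements of $\mathbb{A}$; $a::T$ has head $a$ and tail $T$, $T@T'$ is concatenation. A program is a finite list of instructions generated by $P::=\mathtt{Load}\ i;P\mid A$, $A::=\mathtt{App}(i,j,k);A\mid C$, $C::=\mathtt{Call}\ i\mid\varepsilon$ ($i,j,k\in\mathbb{N}$). For $r\in\mathbb{N}$, $I\subseteq\{0,\dots,r-1\}$, $I\models^r P$ is the least relation such that: $I\models^r\varepsilon$; $I\models^r\mathtt{Call}\ i$ if $i\in I$; $I\models^r\mathtt{App}(i,j,k);A$ if $i,j\in I$ and either ($k<r$ and $I\cup\{k\}\models^r A$) or ($k\ge r$ and $I\models^r A$); $I\models^r\mathtt{Load}\ i;P$ if either ($i<r$ and $I\cup\{i\}\models^r P$) or ($i\ge r$ and $I\models^r P$). An addressing machine is $M=\langle R_0,\dots,R_{r-1},P,T\rangle$ with registers in $\mathbb{A}_\varnothing$, $P$ valid w.r.t. the registers ($\{i<r\mid R_i\ne\varnothing\}\models^r P$), and a tape $T$; $\mathcal{M}$ is the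 set of all of them. $\vec R[R_i:=a]$ replaces $R_i$ by $a$ if $i<r$, is $\vec R$ if $i\ge r$. $M$ is stuck if $M.P=\mathtt{Load}\ i;P'$ and $M.T=[]$. Fix a bijection $\#:\mathcal{M}\to\mathbb{A}$ with inverse $\#^{ -1}$; $M@T'=\langle M.\vec R,M.P,M.T@T'\rangle$; $a\cdot b=\#(\#^{ -1}(a)@[b])$. Head reduction: $\langle\vec R,\mathtt{Load}\ i;P,a::T\rangle\to_h\langle\vec R[R_i:=a],P,T\rangle$, $\langle\vec R,\mathtt{App}(i,j,k);P,T\rangle\to_h\langle\vec R[R_k:=R_i\cdot R_j],P,T\rangle$, $\langle\vec R,\mathtt{Call}\ i,T\rangle\to_h\#^{ -1}(R_i)@T$; $\twoheadrightarrow_h$ reflexive-transitive closure; "$M\twoheadrightarrow_h\mathrm{stuck}$" means $M\twoheadrightarrow_h N$ for some stuck $N$. Induced relations: for a relation $\equiv_R$ on $\mathcal{M}$, $a\simeq_R b$ iff $\#^{ -1}(a)\equiv_R\#^{ -1}(b)$; on $\mathbb{A}_\varnothing$, both $\varnothing$ or both addresses related; componentwise on tuples/tapes of equal length; $M=_R N$ iff $M.\vec R\simeq_R N.\vec R$, $M.P=N.P$, $M.T\simeq_R N.T$. Applicative equivalence $\equiv^{ae}$ is the least equivalence relation on $\mathcal{M}$ such that: (1) $M\twoheadrightarrow_h Z=^{ae}N$ implies $M\equiv^{ae}N$; (2) if $M\twoheadrightarrow_h\mathrm{stuck}$, $N\twoheadrightarrow_h\mathrm{stuck}$ and $M@[a]\equiv^{ae}N@[a]$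 for all $a\in\mathbb{A}$, then $M\equiv^{ae}N$; $\simeq^{ae},=^{ae}$ induced by $\equiv^{ae}$. Interpretation: for $\lambda$-terms possibly containing constants $\underline{a}$ ($a\in\mathbb{A}$) and a list $\vec x=x_1,\dots,x_n$ of distinct variables containing $\mathrm{FV}(M)$: $[\![x_i]\!]^{\vec x}=\langle\varnothing,(\mathtt{Load}\ 1)^{i-1};\mathtt{Load}\ 0;(\mathtt{Load}\ 1)^{n-i};\mathtt{Call}\ 0,[]\rangle$; $[\![\underline{a}]\!]^{\vec x}=\langle a,(\mathtt{Load}\ 1)^n;\mathtt{Call}\ 0,[]\rangle$; $[\![MN]\!]^{\vec x}=\langle\varnothing^n,\#[\![M]\!]^{\vec x},\#[\![N]\!]^{\vec x},\varnothing,\mathtt{Apply}_n,[]\rangle$ with $\mathtt{Apply}_n=\mathtt{Load}\ 0;\dots;\mathtt{Load}\ (n-1);\mathtt{App}(n,0,n);\dots;\mathtt{App}(n,n-1,n);\mathtt{App}(n+1,0,n+1);\dots;\mathtt{App}(n+1,n-1,n+1);\mathtt{App}(n,n+1,n+2);\mathtt{Call}\ (n+2)$; $[\![\lambda y.M]\!]^{\vec x}=[\![M]\!]^{\vec x,y}$. The syntactic $\lambda$-model $\mathcal{S}$ has carrier $\mathbb{A}/_{\simeq^{ae}}$, application $[a]\bullet[b]=[a\cdot b]$, and $[\![M]\!]_\rho=[\#([\![M]\!]^{\vec x}@[\rho(x_1),\dots,\rho(x_n)])]$ for valuations $\rho:\mathrm{Var}\to\mathbb{A}$; for closed $M$ write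 $[\![M]\!]$. A combinatory algebra is extensional if $\forall x\forall y(\forall z\,(xz=yz)\Rightarrow x=y)$. -}

module Defs where

open import Data.Nat using (ℕ; zero; suc; _<_; _≤_; _≡ᵇ_)
open import Data.Bool using (Bool; true; false; _∨_)
open import Data.Maybe using (Maybe; just; nothing; is-just)
open import Data.List using (List; []; _∷_; _++_; length; [_])
open import Data.Product using (Σ; _×_; _,_; proj₁; proj₂; ∃)
open import Data.Sum using (_⊎_)
open import Function.Bundles using (_↔_; Inverse)
open import Relation.Binary.PropositionalEquality using (_≡_)
open import Relation.Binary.Construct.Closure.ReflexiveTransitive using (Star)

data CProg : Set where
  ε    : CProg
  call : ℕ → CProg

data AProg : Set where
  app : ℕ → ℕ → ℕ → AProg → AProg
  ret : CProg → AProg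

data Prog : Set where
  load : ℕ → Prog → Prog
  apps : AProg → Prog

Sub : Set
Sub = ℕ → Bool

_∈ₛ_ : ℕ → Sub → Set
i ∈ₛ I = I i ≡ true

insert : ℕ → Sub → Sub
insert k I j = (k ≡ᵇ j) ∨ I j

data _⊨C[_]_ (I : Sub) (r : ℕ) : CProg → Set where
  ⊨ε    : I ⊨C[ r ] ε
  ⊨call : ∀ {i} → i ∈ₛ I → I ⊨C[ r ] call i

data _⊨A[_]_ : Sub → ℕ → AProg → Set where
  ⊨ret    : ∀ {I r C} → I ⊨C[ r ] C → I ⊨A[ r ] ret C
  ⊨app-in : ∀ {I r i j k A} → i ∈ₛ I → j ∈ₛ I → k < r →
            insert k I ⊨A[ r ] A → I ⊨A[ r ] app i j k A
  ⊨app-out : ∀ {I r i j k A} → i ∈ₛ I → j ∈ₛ I → r ≤ k →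
            I ⊨A[ r ] A → I ⊨A[ r ] app i j k A

data _⊨P[_]_ : Sub → ℕ → Prog → Set where
  ⊨apps     : ∀ {I r A} → I ⊨A[ r ] A → I ⊨P[ r ] apps A
  ⊨load-in  : ∀ {I r i P} → i < r → insert i I ⊨P[ r ] P → I ⊨P[ r ] load i P
  ⊨load-out : ∀ {I r i P} → r ≤ i → I ⊨P[ r ] P → I ⊨P[ r ] load i P

-- Raw machines over a set of addresses A (∅ is represented by nothing)
-- The number r of registers is the length of the register list.

record RawMachine (A : Set) : Set where
  constructor ⟨_,_,_⟩
  field
    regs : List (Maybe A)
    prog : Prog
    tape : List A
open RawMachine public

-- register lookup (nothing = ∅, also used for out-of-range indices)
reg : {A : Set} → List (Maybe A) → ℕ → Maybe A
reg []       _       = nothing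
reg (x ∷ R)  zero    = x
reg (x ∷ R)  (suc i) = reg R i

setReg : {A : Set} → List (Maybe A) → ℕ → Maybe A → List (Maybe A)
setReg []      _       a = []
setReg (x ∷ R) zero    a = a ∷ R
setReg (x ∷ R) (suc i) a = x ∷ setReg R i a

nonEmpty : {A : Set} → List (Maybe A) → Sub
nonEmpty R i = is-just (reg R i)

Valid : {A : Set} → RawMachine A → Set
Valid M = nonEmpty (regs M) ⊨P[ length (regs M) ] prog M

Machine : Set → Set
Machine A = Σ (RawMachine A) Valid

_◂_ : {A : Set} → Machine A → List A → Machine A
(⟨ R , P , T ⟩ , v) ◂ T' = ⟨ R , P , T ++ T' ⟩ , v

record AddrSystem : Set₁ where
  field
    Addr      : Set
    countable : Addr ↔ ℕ
    code      : Machine Addr ↔ Addr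

module AM (S : AddrSystem) where
  open AddrSystem S

  # : Machine Addr → Addr
  # = Inverse.to code

  #⁻¹ : Addr → Machine Addr
  #⁻¹ = Inverse.from code

  _·_ : Addr → Addr → Addr
  a · b = # (#⁻¹ a ◂ [ b ])

  Raw : Set
  Raw = RawMachine Addr

  -- head reduction (on raw machines; it preserves validity)
  data _→h_ : Raw → Raw → Set where
    h-load : ∀ {R i P a T} →
      ⟨ R , load i P , a ∷ T ⟩ →h ⟨ setReg R i (just a) , P , T ⟩
    h-app : ∀ {R i j k A T a b} → reg R i ≡ just a → reg R j ≡ just b →
      ⟨ R , apps (app i j k A) , T ⟩ →h ⟨ setReg R k (just (a · b)) , apps A , T ⟩
    h-call : ∀ {R i T a} → reg R i ≡ just a →
      ⟨ R , apps (ret (call i)) , T ⟩ →h proj₁ (#⁻¹ a ◂ T)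

  _↠h_ : Raw → Raw → Set
  _↠h_ = Star _→h_

  Stuck : Raw → Set
  Stuck M = Σ ℕ λ i → Σ Prog λ P → (prog M ≡ load i P) × (tape M ≡ [])

  _↠stuck : Raw → Set
  M ↠stuck = Σ Raw λ N → (M ↠h N) × Stuck N

  mutual
    data _≡ae_ : Machine Addr → Machine Addr → Set where
      ae-refl  : ∀ {M} → M ≡ae M
      ae-sym   : ∀ {M N} → M ≡ae N → N ≡ae M
      ae-trans : ∀ {M N L} → M ≡ae N → N ≡ae L → M ≡ae L
      ae-red   : ∀ {M N} {Z : Raw} → proj₁ M ↠h Z → Z =ae proj₁ N → M ≡ae N
      ae-stuck : ∀ {M N} → proj₁ M ↠stuck → proj₁ N ↠stuck →
                 (∀ a → (M ◂ [ a ]) ≡ae (N ◂ [ a ])) → M ≡ae N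

    data RegAE : Maybe Addr → Maybe Addr → Set where
      reg-∅    : RegAE nothing nothing
      reg-addr : ∀ {a b} → #⁻¹ a ≡ae #⁻¹ b → RegAE (just a) (just b)

    data RegsAE : List (Maybe Addr) → List (Maybe Addr) → Set where
      []  : RegsAE [] []
      _∷_ : ∀ {x y R R'} → RegAE x y → RegsAE R R' → RegsAE (x ∷ R) (y ∷ R')

    data TapeAE : List Addr → List Addr → Set where
      []  : TapeAE [] []
      _∷_ : ∀ {a b T T'} → #⁻¹ a ≡ae #⁻¹ b → TapeAE T T' → TapeAE (a ∷ T) (b ∷ T')

    data _=ae_ : Raw → Raw → Set where
      mk=ae : ∀ {M N} → RegsAE (regs M) (regs N) → prog M ≡ prog N →
              TapeAE (tape M) (tape N) → M =ae N

  _≃ae_ : Addr → Addr → Set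
  a ≃ae b = #⁻¹ a ≡ae #⁻¹ b

{-# OPTIONS --safe #-}
-- Whether a machine gets stuck after its tape is extended by some tape T is an
-- invariant of applicative equivalence. The only delicate point is the rule
-- that compares machines register by register: App combines registers with
-- `·`, so the invariant has to be closed under application before it can be
-- pushed through a run. With the invariant in hand, extensionality fails: the
-- η-expansion ⟨a, ∅; Load 1; App(0,1,0); Call 0; []⟩ of an address a agrees
-- with a on every argument, and it is stuck as it stands, whereas the machine
-- ⟨; ε; []⟩ with the empty program never gets stuck.
module Submission where

open import Defs
open import Relation.Nullary using (¬_)
open import Data.Nat using (ℕ; zero; suc; s≤s; z≤n)
open import Data.Maybe using (Maybe; just; nothing)
open import Data.Maybe.Properties using (just-injective)
open import Data.Maybe.Relation.Binary.Pointwise as Maybe using (just; nothing; just-inv)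
open import Data.List using (List; []; _∷_; _++_; [_])
open import Data.List.Properties using (++-assoc; ++-identityʳ)
open import Data.List.Relation.Binary.Pointwise as List using (Pointwise; []; _∷_; ++⁺)
open import Data.Product using (∃; _×_; _,_; -,_; proj₁)
open import Data.Empty using (⊥-elim)
open import Function.Bundles using (Inverse; _⇔_; mk⇔; Equivalence)
open import Function.Construct.Composition using (_⇔-∘_)
open import Function.Construct.Identity using (⇔-id)
open import Function.Construct.Symmetry using (⇔-sym)
open import Relation.Binary.PropositionalEquality using (_≡_; refl; sym; trans; cong; subst; subst₂)
open import Relation.Binary.Construct.Closure.ReflexiveTransitive using (ε; _◅_; _◅◅_)

module _ {A : Set} where

  infixl 25 _◃_

  _◃_ : RawMachine A → List A → RawMachine A
  ⟨ R , P , T ⟩ ◃ T' = ⟨ R , P , T ++ T' ⟩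

  ◃-[] : (M : RawMachine A) → M ◃ [] ≡ M
  ◃-[] M = cong ⟨ regs M , prog M ,_⟩ (++-identityʳ (tape M))

  ◃-++ : (M : RawMachine A) (T U : List A) → M ◃ T ◃ U ≡ M ◃ (T ++ U)
  ◃-++ M T U = cong ⟨ regs M , prog M ,_⟩ (++-assoc (tape M) T U)

  module _ {_∼_ : A → A → Set} where

    reg-just⁺ : ∀ {Rs Rs' a} i → Pointwise (Maybe.Pointwise _∼_) Rs Rs' →
                reg Rs i ≡ just a → ∃ λ b → reg Rs' i ≡ just b × a ∼ b
    reg-just⁺ zero    (m ∷ _)  refl = just-inv m
    reg-just⁺ (suc i) (_ ∷ rs) p    = reg-just⁺ i rs p

    setReg⁺ : ∀ {Rs Rs' m m'} i → Pointwise (Maybe.Pointwise _∼_) Rs Rs' →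
              Maybe.Pointwise _∼_ m m' →
              Pointwise (Maybe.Pointwise _∼_) (setReg Rs i m) (setReg Rs' i m')
    setReg⁺ i       []       _ = []
    setReg⁺ zero    (_ ∷ rs) m = m ∷ rs
    setReg⁺ (suc i) (x ∷ rs) m = x ∷ setReg⁺ i rs m

module _ (S : AddrSystem) where
  open AddrSystem S
  open AM S

  #⁻¹-# : ∀ M → #⁻¹ (# M) ≡ M
  #⁻¹-# = Inverse.strictlyInverseʳ code

  #⁻¹-·-◃ : ∀ a b T → proj₁ (#⁻¹ (a · b)) ◃ T ≡ proj₁ (#⁻¹ a) ◃ (b ∷ T)
  #⁻¹-·-◃ a b T = trans (cong (λ M → proj₁ M ◃ T) (#⁻¹-# (#⁻¹ a ◂ [ b ])))
                        (◃-++ (proj₁ (#⁻¹ a)) [ b ] T)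

  →h-deterministic : ∀ {M N₁ N₂} → M →h N₁ → M →h N₂ → N₁ ≡ N₂
  →h-deterministic h-load h-load = refl
  →h-deterministic (h-app p q) (h-app p' q')
    with just-injective (trans (sym p) p') | just-injective (trans (sym q) q')
  ... | refl | refl = refl
  →h-deterministic (h-call p) (h-call p') with just-injective (trans (sym p) p')
  ... | refl = refl

  stuck-irreducible : ∀ {M N} → Stuck M → ¬ (M →h N)
  stuck-irreducible (_ , _ , refl , ()) h-load

  ↠stuck-reduct : ∀ {M Z} → M ↠h Z → M ↠stuck → Z ↠stuck
  ↠stuck-reduct ε        st              = st
  ↠stuck-reduct (s ◅ _)  (_ , ε , stuck) = ⊥-elim (stuck-irreducible stuck s)
  ↠stuck-reduct (s ◅ ss) (W , s' ◅ ss' , stuck) with →h-deterministic s s'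
  ... | refl = ↠stuck-reduct ss (W , ss' , stuck)

  ↠stuck-expand : ∀ {M Z} → M ↠h Z → Z ↠stuck → M ↠stuck
  ↠stuck-expand r (W , r' , stuck) = W , r ◅◅ r' , stuck

  →h-◃ : ∀ {M N} T → M →h N → M ◃ T →h N ◃ T
  →h-◃ T h-load      = h-load
  →h-◃ T (h-app p q) = h-app p q
  →h-◃ {⟨ R , _ , T₀ ⟩} T (h-call {a = a} p) =
    subst (⟨ R , _ , T₀ ++ T ⟩ →h_) (sym (◃-++ (proj₁ (#⁻¹ a)) T₀ T)) (h-call p)

  ↠h-◃ : ∀ {M N} T → M ↠h N → M ◃ T ↠h N ◃ T
  ↠h-◃ T ε        = ε
  ↠h-◃ T (s ◅ ss) = →h-◃ T s ◅ ↠h-◃ T ss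

  data StuckIn : ℕ → Raw → Set where
    stop : ∀ {M} → Stuck M → StuckIn zero M
    step : ∀ {n M M'} → M →h M' → StuckIn n M' → StuckIn (suc n) M

  ↠stuck⇒StuckIn : ∀ {M} → M ↠stuck → ∃ λ n → StuckIn n M
  ↠stuck⇒StuckIn (_ , ε , stuck)      = -, stop stuck
  ↠stuck⇒StuckIn (W , s ◅ ss , stuck) with ↠stuck⇒StuckIn (W , ss , stuck)
  ... | n , st = suc n , step s st

  StuckEquiv : Raw → Raw → Set
  StuckEquiv M N = ∀ T → (M ◃ T) ↠stuck ⇔ (N ◃ T) ↠stuck

  _≈_ : Addr → Addr → Set
  a ≈ b = StuckEquiv (proj₁ (#⁻¹ a)) (proj₁ (#⁻¹ b))

  data _∼_ : Addr → Addr → Set where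
    ≈⇒∼    : ∀ {a b} → a ≈ b → a ∼ b
    ·-cong : ∀ {a₁ b₁ a₂ b₂} → a₁ ∼ b₁ → a₂ ∼ b₂ → (a₁ · a₂) ∼ (b₁ · b₂)

  ∼-refl : ∀ {a} → a ∼ a
  ∼-refl = ≈⇒∼ (λ _ → ⇔-id _)

  ∼-sym : ∀ {a b} → a ∼ b → b ∼ a
  ∼-sym (≈⇒∼ e)      = ≈⇒∼ (λ T → ⇔-sym (e T))
  ∼-sym (·-cong p q) = ·-cong (∼-sym p) (∼-sym q)

  Regs∼ : List (Maybe Addr) → List (Maybe Addr) → Set
  Regs∼ = Pointwise (Maybe.Pointwise _∼_)

  data Related : Raw → Raw → Set where
    related : ∀ {R R' P T T'} → Regs∼ R R' → Pointwise _∼_ T T' →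
              Related ⟨ R , P , T ⟩ ⟨ R' , P , T' ⟩

  Related-sym : ∀ {M N} → Related M N → Related N M
  Related-sym (related rs ts) =
    related (List.symmetric (Maybe.sym ∼-sym) rs) (List.symmetric ∼-sym ts)

  Related-◃ : ∀ {M N} T → Related M N → Related (M ◃ T) (N ◃ T)
  Related-◃ T (related rs ts) = related rs (++⁺ ts (List.refl ∼-refl))

  -- The step count n, rather than the run itself, carries the recursion: the
  -- ·-cong case has to transport the run along #⁻¹-·-◃.
  mutual
    simulation : ∀ n {M N} → Related M N → StuckIn n M → N ↠stuck
    simulation zero (related _ []) (stop (i , P , refl , refl)) = -, ε , (i , P , refl , refl)
    simulation (suc n) (related rs (t ∷ ts)) (step h-load st) =
      ↠stuck-expand (h-load ◅ ε) (simulation n (related (setReg⁺ _ rs (just t)) ts) st)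
    simulation (suc n) (related rs ts) (step (h-app {i = i} {j = j} p q) st)
      with reg-just⁺ i rs p | reg-just⁺ j rs q
    ... | _ , p' , a₁∼b₁ | _ , q' , a₂∼b₂ =
      ↠stuck-expand (h-app p' q' ◅ ε)
        (simulation n (related (setReg⁺ _ rs (just (·-cong a₁∼b₁ a₂∼b₂))) ts) st)
    simulation (suc n) (related rs ts) (step (h-call {i = i} p) st) with reg-just⁺ i rs p
    ... | _ , p' , a∼b = ↠stuck-expand (h-call p' ◅ ε) (call-simulation n a∼b ts st)

    call-simulation : ∀ n {a b T T'} → a ∼ b → Pointwise _∼_ T T' →
                      StuckIn n (proj₁ (#⁻¹ a) ◃ T) → (proj₁ (#⁻¹ b) ◃ T') ↠stuck
    call-simulation n {T' = T'} (≈⇒∼ a≈b) ts st =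
      Equivalence.to (a≈b T')
        (simulation n (related (List.refl (Maybe.refl ∼-refl)) (++⁺ (List.refl ∼-refl) ts)) st)
    call-simulation n {T = T} {T'} (·-cong {a₁} {b₁} {a₂} {b₂} p q) ts st =
      subst _↠stuck (sym (#⁻¹-·-◃ b₁ b₂ T'))
        (call-simulation n p (q ∷ ts) (subst (StuckIn n) (#⁻¹-·-◃ a₁ a₂ T) st))

  Related-↠stuck : ∀ {M N} → Related M N → M ↠stuck → N ↠stuck
  Related-↠stuck rel st with ↠stuck⇒StuckIn st
  ... | n , st' = simulation n rel st'

  Related⇒StuckEquiv : ∀ {M N} → Related M N → StuckEquiv M N
  Related⇒StuckEquiv rel T =
    mk⇔ (Related-↠stuck (Related-◃ T rel)) (Related-↠stuck (Related-sym (Related-◃ T rel)))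

  ↠h⇒StuckEquiv : ∀ {M Z} → M ↠h Z → StuckEquiv M Z
  ↠h⇒StuckEquiv r T = mk⇔ (↠stuck-reduct (↠h-◃ T r)) (↠stuck-expand (↠h-◃ T r))

  StuckEquiv-stuck : ∀ {M N} → M ↠stuck → N ↠stuck →
                     (∀ a → StuckEquiv (M ◃ [ a ]) (N ◃ [ a ])) → StuckEquiv M N
  StuckEquiv-stuck {M} {N} sM sN _ [] =
    mk⇔ (λ _ → subst _↠stuck (sym (◃-[] N)) sN) (λ _ → subst _↠stuck (sym (◃-[] M)) sM)
  StuckEquiv-stuck {M} {N} _ _ h (a ∷ T) =
    subst₂ _⇔_ (cong _↠stuck (◃-++ M [ a ] T)) (cong _↠stuck (◃-++ N [ a ] T)) (h a T)

  mutual
    ≡ae⇒StuckEquiv : ∀ {M N} → M ≡ae N → StuckEquiv (proj₁ M) (proj₁ N)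
    ≡ae⇒StuckEquiv ae-refl T          = ⇔-id _
    ≡ae⇒StuckEquiv (ae-sym e) T       = ⇔-sym (≡ae⇒StuckEquiv e T)
    ≡ae⇒StuckEquiv (ae-trans e f) T   = ≡ae⇒StuckEquiv f T ⇔-∘ ≡ae⇒StuckEquiv e T
    ≡ae⇒StuckEquiv (ae-red r e) T     = Related⇒StuckEquiv (=ae⇒Related e) T ⇔-∘ ↠h⇒StuckEquiv r T
    ≡ae⇒StuckEquiv (ae-stuck sM sN h) = StuckEquiv-stuck sM sN (λ a → ≡ae⇒StuckEquiv (h a))

    =ae⇒Related : ∀ {Z N} → Z =ae N → Related Z N
    =ae⇒Related (mk=ae rs refl ts) = related (RegsAE⇒Regs∼ rs) (TapeAE⇒Pointwise ts)

    RegsAE⇒Regs∼ : ∀ {R R'} → RegsAE R R' → Regs∼ R R'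
    RegsAE⇒Regs∼ []                = []
    RegsAE⇒Regs∼ (reg-∅ ∷ rs)      = nothing ∷ RegsAE⇒Regs∼ rs
    RegsAE⇒Regs∼ (reg-addr e ∷ rs) = just (≈⇒∼ (≡ae⇒StuckEquiv e)) ∷ RegsAE⇒Regs∼ rs

    TapeAE⇒Pointwise : ∀ {T T'} → TapeAE T T' → Pointwise _∼_ T T'
    TapeAE⇒Pointwise []       = []
    TapeAE⇒Pointwise (e ∷ ts) = ≈⇒∼ (≡ae⇒StuckEquiv e) ∷ TapeAE⇒Pointwise ts

  ≡ae-↠stuck : ∀ {M N} → M ≡ae N → proj₁ M ↠stuck → proj₁ N ↠stuck
  ≡ae-↠stuck {M} {N} e st =
    subst _↠stuck (◃-[] (proj₁ N))
      (Equivalence.to (≡ae⇒StuckEquiv e []) (subst _↠stuck (sym (◃-[] (proj₁ M))) st))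

  ≃ae-#-↠stuck : ∀ {M N} → # M ≃ae # N → proj₁ M ↠stuck → proj₁ N ↠stuck
  ≃ae-#-↠stuck {M} {N} e st =
    subst (λ L → proj₁ L ↠stuck) (#⁻¹-# N)
      (≡ae-↠stuck e (subst (λ L → proj₁ L ↠stuck) (sym (#⁻¹-# M)) st))

  =ae-refl : ∀ M → M =ae M
  =ae-refl M = mk=ae (regs-refl (regs M)) refl (tape-refl (tape M))
    where
    regs-refl : ∀ R → RegsAE R R
    regs-refl []            = []
    regs-refl (nothing ∷ R) = reg-∅ ∷ regs-refl R
    regs-refl (just _ ∷ R)  = reg-addr ae-refl ∷ regs-refl R

    tape-refl : ∀ T → TapeAE T T
    tape-refl []      = []
    tape-refl (_ ∷ T) = ae-refl ∷ tape-refl T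

  halted : Machine Addr
  halted = ⟨ [] , apps (ret ε) , [] ⟩ , ⊨apps (⊨ret ⊨ε)

  halted-never-stuck : ¬ (proj₁ halted ↠stuck)
  halted-never-stuck (_ , ε , (_ , _ , () , _))
  halted-never-stuck (_ , () ◅ _ , _)

  η-expand : Addr → Machine Addr
  η-expand a =
    ⟨ just a ∷ nothing ∷ [] , load 1 (apps (app 0 1 0 (ret (call 0)))) , [] ⟩ ,
    ⊨load-in (s≤s (s≤s z≤n)) (⊨apps (⊨app-in refl refl (s≤s z≤n) (⊨ret (⊨call refl))))

  η-expand-stuck : ∀ a → proj₁ (η-expand a) ↠stuck
  η-expand-stuck a = -, ε , (1 , _ , refl , refl)

  η-expand-· : ∀ a z → (# (η-expand a) · z) ≃ae (a · z)
  η-expand-· a z =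
    subst (_≡ae #⁻¹ (a · z)) (sym #⁻¹-η·z)
      (ae-red (h-load ◅ h-app refl refl ◅ h-call refl ◅ ε)
              (subst (_=ae proj₁ (#⁻¹ (a · z))) (sym (◃-[] _)) (=ae-refl _)))
    where
    #⁻¹-η·z : #⁻¹ (# (η-expand a) · z) ≡ η-expand a ◂ [ z ]
    #⁻¹-η·z = trans (#⁻¹-# _) (cong (_◂ [ z ]) (#⁻¹-# (η-expand a)))

lemma4p12 : (S : AddrSystem) →
              let open AddrSystem S
                  open AM S
              in ¬ (∀ (x y : Addr) → (∀ (z : Addr) → (x · z) ≃ae (y · z)) → x ≃ae y)
lemma4p12 S ext =
  halted-never-stuck S (≃ae-#-↠stuck S η-expand-c≃c (η-expand-stuck S c))
  where
  open AddrSystem S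
  open AM S

  c : Addr
  c = # (halted S)

  η-expand-c≃c : # (η-expand S c) ≃ae c
  η-expand-c≃c = ext (# (η-expand S c)) c (η-expand-· S c)
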